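{- The chirality group $X(\mathcal H)$ of every orientably regular hypermap $\mathcal H$ is isomorphic to a normal subgroup of the monodromy group $\mathrm{Mon}(\mathcal H)$.
   Context: Let $\Delta=\langle r_0,r_1,r_2\mid r_0^2=r_1^2=r_2^2=1\rangle$ and let $\Delta^+$ be its index-$2$ subgroup of even-length words, generated by $\rho=r_1r_2$ and $\lambda=r_2r_0$. An (oriented) hypermap is a triple $\mathcal H=(D,R,L)$ with $D$ a finite set and $R,L$ permutations of $D$ such that the monodromy group $\mathrm{Mon}(\mathcal H)=\langle R,L\rangle$ is transitive on $D$. It is orientably regular if its automorphism group (permutations of $D$ commuting with $R$ and $L$) acts regularly on $D$; then $\mathcal H\cong(\Delta^+/H,\rho,\lambda)$ (left multiplication on cosets) for a unique normal subgroup $H$ of finite index in $\Delta^+$ (the hypermap subgroup), and $\mathrm{Mon}(\mathcal H)\cong\Delta^+/H$. For $H\trianglelefteq\Delta^+$ put $H^r=r_2Hr_2$. The chirality group is $X(\mathcal H)=HH^r/H$ (isomorphic to $H/(H\cap H^r)$). -}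

module Defs where

import Level
open import Level using (0ℓ)
import Data.Nat
import Data.Nat.Properties
import Relation.Binary.PropositionalEquality
open import Data.Nat using (ℕ; _*_)
open import Data.Nat.Properties using (*-distribˡ-+)
open import Data.Fin using (Fin; zero; suc)
open import Data.List using (List; []; _∷_; _++_; length)
open import Data.List.Properties using (length-++)
open import Data.List.Membership.Propositional using (_∈_)
open import Data.Product using (Σ; ∃; ∃-syntax; _×_; _,_)
open import Relation.Binary.Core using (Rel)
open import Relation.Binary.PropositionalEquality using (_≡_; cong₂; trans; sym)
open import Relation.Binary.Construct.Closure.Equivalence using (EqClosure)
open import Algebra.Bundles.Raw using (RawGroup)
open import Function.Bundles using (_⇔_)
import Algebra.Morphism.Structures as MS

-- The extended triangle group Δ = ⟨ r₀, r₁, r₂ | r₀² = r₁² = r₂² = 1 ⟩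
-- Elements are words in the letters r₀ r₁ r₂ (Fin 3), modulo the
-- equivalence relation generated by deleting a subword rᵢ rᵢ.

Word : Set
Word = List (Fin 3)

r₀ r₁ r₂ : Fin 3
r₀ = zero
r₁ = suc zero
r₂ = suc (suc zero)

data Step : Rel Word 0ℓ where
  cancel : ∀ u i v → Step (u ++ i ∷ i ∷ v) (u ++ v)

infix 4 _≈Δ_
_≈Δ_ : Rel Word 0ℓ
_≈Δ_ = EqClosure Step

-- inverse in Δ (generators are involutions): reverse the word
inv : Word → Word
inv []      = []
inv (a ∷ w) = inv w ++ a ∷ []

Even : Word → Set
Even w = ∃[ k ] length w ≡ 2 * k

even-++ : ∀ {u v} → Even u → Even v → Even (u ++ v)
even-++ {u} {v} (k , p) (m , q) =
  (k Data.Nat.+ m) , trans (length-++ u) (trans (cong₂ Data.Nat._+_ p q) (sym (*-distribˡ-+ 2 k m)))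

length-inv : ∀ w → length (inv w) ≡ length w
length-inv []      = Relation.Binary.PropositionalEquality.refl
length-inv (a ∷ w) = trans (length-++ (inv w))
  (trans (Relation.Binary.PropositionalEquality.cong (Data.Nat._+ 1) (length-inv w))
         (Data.Nat.Properties.+-comm (length w) 1))

even-inv : ∀ {u} → Even u → Even (inv u)
even-inv {u} (k , p) = k , trans (length-inv u) p

Δ⁺ : Set
Δ⁺ = Σ Word Even

-- Hypermap subgroups: normal subgroups of finite index in Δ⁺
-- (subsets of Δ given as predicates on words respecting ≈Δ)

record IsHypermapSubgroup (H : Word → Set) : Set where
  field
    resp        : ∀ {u v} → u ≈Δ v → H u → H v
    ⊆Δ⁺         : ∀ {u} → H u → Even u
    ε-closed    : H []
    ∙-closed    : ∀ {u v} → H u → H v → H (u ++ v)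
    inv-closed  : ∀ {u} → H u → H (inv u)
    normal      : ∀ {g u} → Even g → H u → H (g ++ u ++ inv g)
    finiteIndex : ∃[ reps ] (∀ w → Even w →
                    ∃[ r ] (r ∈ reps × H (inv r ++ w)))

_ʳ : (Word → Set) → (Word → Set)
(H ʳ) w = ∃[ h ] (H h × w ≈Δ (r₂ ∷ h ++ r₂ ∷ []))

-- the subgroup H H^r of Δ (the join of H and H^r; since both are normal
-- in Δ⁺ it equals the product set H H^r)
data Join (H K : Word → Set) : Word → Set where
  inH   : ∀ {w} → H w → Join H K w
  inK   : ∀ {w} → K w → Join H K w
  unit  : Join H K []
  mul   : ∀ {u v} → Join H K u → Join H K v → Join H K (u ++ v)
  inver : ∀ {u} → Join H K u → Join H K (inv u)
  respΔ : ∀ {u v} → u ≈Δ v → Join H K u → Join H K v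

-- The monodromy group Mon(ℋ) ≅ Δ⁺ / H  (cosets uH = vH iff u⁻¹v ∈ H)

Mon : (Word → Set) → RawGroup 0ℓ 0ℓ
Mon H = record
  { Carrier = Δ⁺
  ; _≈_     = λ x y → H (inv (Data.Product.proj₁ x) ++ Data.Product.proj₁ y)
  ; _∙_     = λ { (u , p) (v , q) → (u ++ v) , even-++ {u} {v} p q }
  ; ε       = [] , (0 , Relation.Binary.PropositionalEquality.refl)
  ; _⁻¹     = λ { (u , p) → inv u , even-inv {u} p }
  }

X : (Word → Set) → RawGroup 0ℓ 0ℓ
X H = record
  { Carrier = Σ Word (Join H (H ʳ))
  ; _≈_     = λ x y → H (inv (Data.Product.proj₁ x) ++ Data.Product.proj₁ y)
  ; _∙_     = λ { (u , p) (v , q) → (u ++ v) , mul p q }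
  ; ε       = [] , unit
  ; _⁻¹     = λ { (u , p) → inv u , inver p }
  }

record IsNormalSubgroup {c ℓ} (G : RawGroup c ℓ) (N : RawGroup.Carrier G → Set) : Set (c Level.⊔ ℓ) where
  open RawGroup G
  field
    resp       : ∀ {x y} → x ≈ y → N x → N y
    ε-closed   : N ε
    ∙-closed   : ∀ {x y} → N x → N y → N (x ∙ y)
    inv-closed : ∀ {x} → N x → N (x ⁻¹)
    normal     : ∀ g {x} → N x → N ((g ∙ x) ∙ (g ⁻¹))

IsoToNormalSubgroup : RawGroup 0ℓ 0ℓ → RawGroup 0ℓ 0ℓ → Set₁
IsoToNormalSubgroup A G =
  ∃[ N ] (IsNormalSubgroup G N ×
    ∃[ f ] (MS.GroupMorphisms.IsGroupMonomorphism A G f ×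
      (∀ y → N y ⇔ (∃[ x ] (RawGroup._≈_ G (f x) y)))))

{-# OPTIONS --safe #-}
module Submission where

-- Since both H and H^r = r₂ H r₂ are normal in Δ⁺ (r₂ normalises Δ⁺), the
-- subgroup H H^r is normal in Δ⁺; it contains H, so H H^r / H is a normal
-- subgroup of Δ⁺ / H = Mon(ℋ).  The isomorphism is the identity on words.

open import Defs
open import Data.Nat using (suc; _+_; _*_)
open import Data.Nat.Properties using (*-suc; +-comm; +-cancelˡ-≡)
open import Data.Fin using (Fin)
open import Data.List using ([]; _∷_; _++_; length; reverse)
open import Data.List.Properties
  using (++-assoc; ++-identityʳ; length-++; unfold-reverse; reverse-++; reverse-involutive; ++-monoid)
open import Data.Product using (Σ; ∃-syntax; _,_; proj₁; map₂)
open import Algebra.Bundles.Raw using (RawGroup)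
open import Relation.Binary.PropositionalEquality using (_≡_; refl; sym; trans; cong; subst)
open import Relation.Binary.Construct.Closure.ReflexiveTransitive using (_◅_)
open import Relation.Binary.Construct.Closure.Symmetric using (fwd)
import Relation.Binary.Construct.Closure.Equivalence as EqClosure
open import Relation.Binary.Reasoning.Setoid (EqClosure.setoid Step)
open import Relation.Unary using (Pred; _⊆_)
open import Level using (0ℓ)
open import Function.Base using (_∘_; id)
open import Function.Bundles using (_⇔_; mk⇔; Equivalence)
open import Function.Properties.Equivalence using (⇔-isEquivalence)
open import Algebra.Morphism.Structures using (module GroupMorphisms)
open import Algebra.Solver.Monoid (++-monoid (Fin 3)) using (solve; _⊕_; _⊜_)

≈Δ-sym : ∀ {u v} → u ≈Δ v → v ≈Δ u
≈Δ-sym = EqClosure.symmetric Step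

cancel-≈Δ : ∀ u i v → u ++ i ∷ i ∷ v ≈Δ u ++ v
cancel-≈Δ u i v = fwd (cancel u i v) ◅ EqClosure.reflexive Step

Step-++ˡ : ∀ w {u v} → Step u v → Step (w ++ u) (w ++ v)
Step-++ˡ w (cancel u i v)
  rewrite sym (++-assoc w u (i ∷ i ∷ v)) | sym (++-assoc w u v) = cancel (w ++ u) i v

Step-++ʳ : ∀ w {u v} → Step u v → Step (u ++ w) (v ++ w)
Step-++ʳ w (cancel u i v)
  rewrite ++-assoc u (i ∷ i ∷ v) w | ++-assoc u v w = cancel u i (v ++ w)

++-congˡ : ∀ w {u v} → u ≈Δ v → w ++ u ≈Δ w ++ v
++-congˡ w = EqClosure.gmap (w ++_) (Step-++ˡ w)

++-congʳ : ∀ w {u v} → u ≈Δ v → u ++ w ≈Δ v ++ w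
++-congʳ w = EqClosure.gmap (_++ w) (Step-++ʳ w)

inv≗reverse : ∀ w → inv w ≡ reverse w
inv≗reverse []      = refl
inv≗reverse (a ∷ w) = trans (cong (_++ a ∷ []) (inv≗reverse w)) (sym (unfold-reverse a w))

inv-++ : ∀ u v → inv (u ++ v) ≡ inv v ++ inv u
inv-++ u v rewrite inv≗reverse (u ++ v) | inv≗reverse u | inv≗reverse v = reverse-++ u v

inv-involutive : ∀ w → inv (inv w) ≡ w
inv-involutive w rewrite inv≗reverse (inv w) | inv≗reverse w = reverse-involutive w

inv-cancelˡ : ∀ w → inv w ++ w ≈Δ []
inv-cancelˡ []      = EqClosure.reflexive Step
inv-cancelˡ (a ∷ w) = begin
  (inv w ++ a ∷ []) ++ a ∷ w ≡⟨ ++-assoc (inv w) (a ∷ []) (a ∷ w) ⟩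
  inv w ++ a ∷ a ∷ w         ≈⟨ cancel-≈Δ (inv w) a w ⟩
  inv w ++ w                 ≈⟨ inv-cancelˡ w ⟩
  []                         ∎

inv-cancelʳ : ∀ w → w ++ inv w ≈Δ []
inv-cancelʳ w = subst (λ v → v ++ inv w ≈Δ []) (inv-involutive w) (inv-cancelˡ (inv w))

2+-even⇔even : ∀ n → (∃[ k ] 2 + n ≡ 2 * k) ⇔ (∃[ k ] n ≡ 2 * k)
2+-even⇔even n = mk⇔ from-2+ (λ (k , n≡2k) → suc k , trans (cong (2 +_) n≡2k) (sym (*-suc 2 k)))
  where
  from-2+ : ∃[ k ] 2 + n ≡ 2 * k → ∃[ k ] n ≡ 2 * k
  from-2+ (suc k , 2+n≡2k) = k , +-cancelˡ-≡ 2 n (2 * k) (trans 2+n≡2k (*-suc 2 k))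

length-cancel : ∀ u (i : Fin 3) v → length (u ++ i ∷ i ∷ v) ≡ 2 + length (u ++ v)
length-cancel []      i v = refl
length-cancel (a ∷ u) i v = cong suc (length-cancel u i v)

Step⇒Even⇔ : ∀ {u v} → Step u v → Even u ⇔ Even v
Step⇒Even⇔ (cancel u i v) rewrite length-cancel u i v = 2+-even⇔even (length (u ++ v))

Even-resp : ∀ {u v} → u ≈Δ v → Even u → Even v
Even-resp u≈v = Equivalence.to (EqClosure.gfold ⇔-isEquivalence Even Step⇒Even⇔ u≈v)

conj : Word → Word → Word
conj g w = g ++ w ++ inv g

-- Definitionally r₂ ∷ w ++ r₂ ∷ [], the map in the definition of H ʳ.
reflect : Word → Word
reflect = conj (r₂ ∷ [])

Even-reflect : ∀ {w} → Even w → Even (reflect w)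
Even-reflect {w} even-w =
  map₂ (trans length-reflect) (Equivalence.from (2+-even⇔even (length w)) even-w)
  where
  length-reflect : length (reflect w) ≡ 2 + length w
  length-reflect = cong suc (trans (length-++ w) (+-comm (length w) 1))

conj-++ : ∀ g u v → conj g u ++ conj g v ≈Δ conj g (u ++ v)
conj-++ g u v = begin
  (g ++ u ++ inv g) ++ (g ++ v ++ inv g)    ≡⟨ solve 4 (λ g u v g⁻¹ → (g ⊕ u ⊕ g⁻¹) ⊕ (g ⊕ v ⊕ g⁻¹)
                                                  ⊜ (g ⊕ u) ⊕ ((g⁻¹ ⊕ g) ⊕ (v ⊕ g⁻¹))) refl g u v (inv g) ⟩
  (g ++ u) ++ (inv g ++ g) ++ (v ++ inv g)  ≈⟨ ++-congˡ (g ++ u) (++-congʳ (v ++ inv g) (inv-cancelˡ g)) ⟩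
  (g ++ u) ++ (v ++ inv g)                  ≡⟨ solve 4 (λ g u v g⁻¹ → (g ⊕ u) ⊕ (v ⊕ g⁻¹)
                                                  ⊜ g ⊕ (u ⊕ v) ⊕ g⁻¹) refl g u v (inv g) ⟩
  g ++ (u ++ v) ++ inv g                    ∎

inv-conj : ∀ g u → inv (conj g u) ≡ conj g (inv u)
inv-conj g u rewrite inv-++ g (u ++ inv g) | inv-++ u (inv g) | inv-involutive g =
  ++-assoc g (inv u) (inv g)

conj-∘ : ∀ a b w → conj a (conj b w) ≡ conj (a ++ b) w
conj-∘ a b w rewrite inv-++ a b =
  solve 5 (λ a b w a⁻¹ b⁻¹ → a ⊕ (b ⊕ w ⊕ b⁻¹) ⊕ a⁻¹ ⊜ (a ⊕ b) ⊕ w ⊕ b⁻¹ ⊕ a⁻¹)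
    refl a b w (inv a) (inv b)

conj-congʳ : ∀ g {u v} → u ≈Δ v → conj g u ≈Δ conj g v
conj-congʳ g u≈v = ++-congˡ g (++-congʳ (inv g) u≈v)

conj-cancel : ∀ i g w → conj (i ∷ i ∷ g) w ≈Δ conj g w
conj-cancel i g w = begin
  i ∷ i ∷ g ++ w ++ (inv g ++ i ∷ []) ++ i ∷ []  ≡⟨ cong (λ v → i ∷ i ∷ v)
                                                      (solve 4 (λ g w g⁻¹ I → g ⊕ w ⊕ (g⁻¹ ⊕ I) ⊕ I
                                                         ⊜ (g ⊕ w ⊕ g⁻¹) ⊕ (I ⊕ I)) refl g w (inv g) (i ∷ [])) ⟩
  i ∷ i ∷ conj g w ++ i ∷ i ∷ []                 ≈⟨ cancel-≈Δ [] i _ ⟩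
  conj g w ++ i ∷ i ∷ []                         ≈⟨ cancel-≈Δ (conj g w) i [] ⟩
  conj g w ++ []                                 ≡⟨ ++-identityʳ (conj g w) ⟩
  conj g w                                       ∎

conj-reflect : ∀ g h → conj g (reflect h) ≈Δ reflect (conj (reflect g) h)
conj-reflect g h = begin
  conj g (reflect h)             ≡⟨ conj-∘ g (r₂ ∷ []) h ⟩
  conj (g ++ r₂ ∷ []) h          ≈⟨ conj-cancel r₂ (g ++ r₂ ∷ []) h ⟨
  conj (r₂ ∷ reflect g) h        ≡⟨ conj-∘ (r₂ ∷ []) (reflect g) h ⟨
  reflect (conj (reflect g) h)   ∎

Δ⁺-Invariant : Pred Word 0ℓ → Set
Δ⁺-Invariant P = ∀ (g : Δ⁺) {w} → P w → P (conj (proj₁ g) w)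

ʳ-⊆-Even : ∀ {H} → H ⊆ Even → H ʳ ⊆ Even
ʳ-⊆-Even H⊆Even (h , Hh , w≈rh) = Even-resp (≈Δ-sym w≈rh) (Even-reflect {h} (H⊆Even Hh))

ʳ-Δ⁺-invariant : ∀ {H} → Δ⁺-Invariant H → Δ⁺-Invariant (H ʳ)
ʳ-Δ⁺-invariant H-invariant (g , even-g) (h , Hh , w≈rh) =
  conj (reflect g) h ,
  H-invariant (reflect g , Even-reflect {g} even-g) Hh ,
  EqClosure.transitive Step (conj-congʳ g w≈rh) (conj-reflect g h)

Join-⊆-Even : ∀ {H K} → H ⊆ Even → K ⊆ Even → Join H K ⊆ Even
Join-⊆-Even H⊆Even K⊆Even = go
  where
  go : Join _ _ ⊆ Even
  go (inH Hw)             = H⊆Even Hw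
  go (inK Kw)             = K⊆Even Kw
  go unit                 = 0 , refl
  go (mul {u} {v} ju jv)  = even-++ {u} {v} (go ju) (go jv)
  go (inver {u} ju)       = even-inv {u} (go ju)
  go (respΔ u≈v ju)       = Even-resp u≈v (go ju)

Join-Δ⁺-invariant : ∀ {H K} → Δ⁺-Invariant H → Δ⁺-Invariant K → Δ⁺-Invariant (Join H K)
Join-Δ⁺-invariant H-invariant K-invariant (g , even-g) = go
  where
  go : ∀ {w} → Join _ _ w → Join _ _ (conj g w)
  go (inH Hw)             = inH (H-invariant (g , even-g) Hw)
  go (inK Kw)             = inK (K-invariant (g , even-g) Kw)
  go unit                 = respΔ (≈Δ-sym (inv-cancelʳ g)) unit
  go (mul {u} {v} ju jv)  = respΔ (conj-++ g u v) (mul (go ju) (go jv))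
  go (inver {u} ju)       = subst (Join _ _) (inv-conj g u) (inver (go ju))
  go (respΔ u≈v ju)       = respΔ (conj-congʳ g u≈v) (go ju)

Join-coset : ∀ {H K u v} → H (inv u ++ v) → Join H K u → Join H K v
Join-coset {u = u} {v} Hu⁻¹v ju = respΔ u[u⁻¹v]≈v (mul ju (inH Hu⁻¹v))
  where
  u[u⁻¹v]≈v : u ++ inv u ++ v ≈Δ v
  u[u⁻¹v]≈v = begin
    u ++ inv u ++ v    ≡⟨ ++-assoc u (inv u) v ⟨
    (u ++ inv u) ++ v  ≈⟨ ++-congʳ v (inv-cancelʳ u) ⟩
    v                  ∎

module _ (H : Word → Set) (isH : IsHypermapSubgroup H) where
  open IsHypermapSubgroup isH

  HHʳ : Word → Set
  HHʳ = Join H (H ʳ)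

  H-Δ⁺-invariant : Δ⁺-Invariant H
  H-Δ⁺-invariant (g , even-g) = normal {g} even-g

  H-inv-cancelˡ : ∀ w → H (inv w ++ w)
  H-inv-cancelˡ w = resp (≈Δ-sym (inv-cancelˡ w)) ε-closed

  HHʳ-isNormalSubgroup : IsNormalSubgroup (Mon H) (HHʳ ∘ proj₁)
  HHʳ-isNormalSubgroup = record
    { resp       = Join-coset
    ; ε-closed   = unit
    ; ∙-closed   = mul
    ; inv-closed = inver
    ; normal     = λ g {(w , _)} HHʳw →
        subst HHʳ (sym (++-assoc (proj₁ g) w (inv (proj₁ g))))
          (Join-Δ⁺-invariant H-Δ⁺-invariant (ʳ-Δ⁺-invariant H-Δ⁺-invariant) g HHʳw)
    }

  embed : Σ Word HHʳ → Δ⁺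
  embed (w , HHʳw) = w , Join-⊆-Even ⊆Δ⁺ (ʳ-⊆-Even ⊆Δ⁺) HHʳw

  embed-isGroupMonomorphism : GroupMorphisms.IsGroupMonomorphism (X H) (Mon H) embed
  embed-isGroupMonomorphism = record
    { isGroupHomomorphism = record
      { isMonoidHomomorphism = record
        { isMagmaHomomorphism = record
          { isRelHomomorphism = record { cong = id }
          ; homo              = λ (u , _) (v , _) → H-inv-cancelˡ (u ++ v)
          }
        ; ε-homo = ε-closed
        }
      ; ⁻¹-homo = λ (w , _) → H-inv-cancelˡ (inv w)
      }
    ; injective = id
    }

  HHʳ⇔image-embed : ∀ y → HHʳ (proj₁ y) ⇔ (∃[ x ] RawGroup._≈_ (Mon H) (embed x) y)
  HHʳ⇔image-embed (w , _) = mk⇔ (λ HHʳw → (w , HHʳw) , H-inv-cancelˡ w)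
                                (λ ((_ , HHʳu) , Hu⁻¹w) → Join-coset Hu⁻¹w HHʳu)

proposition5 : (H : Word → Set) → IsHypermapSubgroup H → IsoToNormalSubgroup (X H) (Mon H)
proposition5 H isH =
  HHʳ H isH ∘ proj₁ , HHʳ-isNormalSubgroup H isH ,
  embed H isH , embed-isGroupMonomorphism H isH , HHʳ⇔image-embed H isH
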